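{- Let $G=(V,E)$ be a simple undirected graph, $b:V\to\mathbb{Z}_{\ge0}$, and $f:2^E\to\mathbb{R}_{\ge0}$ a normalized, monotone, submodular function. Let $\epsilon\in(0,1]$. Let $M=\{e_1,\dots,e_k\}$ be a maximal $b$-matching produced by adding edges one at a time such that, for each $i$, at the moment $e_i$ is added to $M_{i-1}=\{e_1,\dots,e_{i-1}\}$ the edge $e_i$ is $\epsilon$-locally dominant w.r.t. $M_{i-1}$. Then $f(M)\ge \frac{\epsilon}{2+\epsilon} f(M^*)$, where $M^*$ is a $b$-matching maximizing $f$.
   Context: $\delta(v)$ is the set of edges incident on $v$. A $b$-matching is a set $M\subseteq E$ with $|M\cap\delta(v)|\le b(v)$ for every $v\in V$; $v$ is saturated in $M$ if equality holds. Marginal gain: $\rho_e(A)=f(A\cup\{e\})-f(A)$. Submodular: $\rho_e(A)\ge\rho_e(B)$ whenever $A\subseteq B\subseteq E$, $e\in E\setminus B$; monotone: $f(A)\le f(B)$ for $A\subseteq B$; normalized: $f(\emptyset)=0$. An edge $e\notin M$ is available w.r.t. $M$ if both endpoints are unsaturated in $M$. Two distinct edges are adjacent if they share an endpoint. An edge $e$ is $\epsilon$-locally dominant w.r.t. $M$ if it is available w.r.t. $M$ and $\rho_e(M)\ge\epsilon\,\rho_{e'}(M)$ for every edge $e'$ adjacent to $e$ that is available w.r.t. $M$. A $b$-matching is maximal if no edge is available w.r.t. it. -}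

module Defs where

open import Level using (Level; suc; _⊔_)
open import Data.Nat as ℕ using (ℕ)
open import Data.Bool using (Bool; true; false; if_then_else_)
open import Data.Fin using (Fin)
open import Data.Fin.Subset using (Subset; _∈_; _∉_; _⊆_; _∪_; _∩_; ⁅_⁆; ∣_∣; ⊥)
open import Data.Product using (Σ; _×_; _,_; proj₁; proj₂; ∃; ∃-syntax)
open import Data.Sum using (_⊎_)
open import Data.Vec using (Vec; []; _∷_; tabulate; take)
open import Data.List using (List; []; _∷_; length; lookup)
open import Relation.Binary.PropositionalEquality using (_≡_; _≢_)
open import Relation.Nullary using (¬_)
open import Relation.Nullary.Decidable using (⌊_⌋)
open import Relation.Binary using (IsTotalOrder)
open import Algebra.Bundles using (CommutativeRing) public
open import Data.Fin.Properties using (_≟_)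

-- Ordered fields (the stdlib has no reals; ℝ is an instance of this
-- record, and the theorem is stated for an arbitrary ordered field).

record OrderedField (c ℓ₁ ℓ₂ : Level) : Set (suc (c ⊔ ℓ₁ ⊔ ℓ₂)) where
  field
    commutativeRing : CommutativeRing c ℓ₁
  open CommutativeRing commutativeRing public
  field
    _≤_         : Carrier → Carrier → Set ℓ₂
    isTotalOrder : IsTotalOrder _≈_ _≤_
    +-mono-≤    : ∀ {a b} c → a ≤ b → (a + c) ≤ (b + c)
    *-nonneg    : ∀ {a b} → 0# ≤ a → 0# ≤ b → 0# ≤ (a * b)
    0≉1         : ¬ (0# ≈ 1#)
    _⁻¹         : (x : Carrier) → ¬ (x ≈ 0#) → Carrier
    ⁻¹-inverse  : ∀ x (x≉0 : ¬ (x ≈ 0#)) → (x * (x ⁻¹) x≉0) ≈ 1#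

  _<_ : Carrier → Carrier → Set (ℓ₁ ⊔ ℓ₂)
  a < b = (a ≤ b) × ¬ (a ≈ b)

  2# : Carrier
  2# = 1# + 1#

record SimpleGraph (n m : ℕ) : Set where
  field
    ends     : Fin m → Fin n × Fin n
    loopless : ∀ e → proj₁ (ends e) ≢ proj₂ (ends e)
    noMulti  : ∀ e e' → ends e ≡ ends e' ⊎ ends e ≡ (proj₂ (ends e') , proj₁ (ends e'))
                      → e ≡ e'

module _ {n m : ℕ} (G : SimpleGraph n m) where
  open SimpleGraph G

  IncidentTo : Fin n → Fin m → Set
  IncidentTo v e = v ≡ proj₁ (ends e) ⊎ v ≡ proj₂ (ends e)

  incident? : Fin n → Fin m → Bool
  incident? v e = if ⌊ v ≟ proj₁ (ends e) ⌋ then true else ⌊ v ≟ proj₂ (ends e) ⌋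

  δ : Fin n → Subset m
  δ v = tabulate (incident? v)

  deg : Subset m → Fin n → ℕ
  deg M v = ∣ M ∩ δ v ∣

  IsBMatching : (Fin n → ℕ) → Subset m → Set
  IsBMatching b M = ∀ v → deg M v ℕ.≤ b v

  Saturated : (Fin n → ℕ) → Subset m → Fin n → Set
  Saturated b M v = deg M v ≡ b v

  Available : (Fin n → ℕ) → Subset m → Fin m → Set
  Available b M e = e ∉ M × ¬ Saturated b M (proj₁ (ends e))
                          × ¬ Saturated b M (proj₂ (ends e))

  Adjacent : Fin m → Fin m → Set
  Adjacent e e' = e ≢ e' × ∃[ v ] (IncidentTo v e × IncidentTo v e')

  IsMaximalBMatching : (Fin n → ℕ) → Subset m → Set
  IsMaximalBMatching b M = IsBMatching b M × (∀ e → ¬ Available b M e)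

  toSet : List (Fin m) → Subset m
  toSet [] = ⊥
  toSet (e ∷ es) = ⁅ e ⁆ ∪ toSet es

  module _ {c ℓ₁ ℓ₂} (F : OrderedField c ℓ₁ ℓ₂) where
    open OrderedField F

    ρ : (Subset m → Carrier) → Fin m → Subset m → Carrier
    ρ f e A = f (A ∪ ⁅ e ⁆) - f A

    Normalized : (Subset m → Carrier) → Set ℓ₁
    Normalized f = f ⊥ ≈ 0#

    NonNegative : (Subset m → Carrier) → Set ℓ₂
    NonNegative f = ∀ A → 0# ≤ f A

    Monotone : (Subset m → Carrier) → Set ℓ₂
    Monotone f = ∀ A B → A ⊆ B → f A ≤ f B

    Submodular : (Subset m → Carrier) → Set ℓ₂
    Submodular f = ∀ A B e → A ⊆ B → e ∉ B → ρ f e B ≤ ρ f e A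

    LocallyDominant : (Fin n → ℕ) → (Subset m → Carrier) → Carrier
                    → Subset m → Fin m → Set (ℓ₂)
    LocallyDominant b f ε M e =
      Available b M e ×
      (∀ e' → Adjacent e e' → Available b M e' → (ε * ρ f e' M) ≤ ρ f e M)

{-# OPTIONS --safe #-}
module Submission where

-- Charge every edge e ∈ M* ∖ M to the endpoint v that blocked it first: v is saturated in the
-- first prefix Mⱼ of the greedy sequence with respect to which e is unavailable.  Saturation
-- persists, so every step i adding an edge eᵢ at v comes before j; e was still available then,
-- and local dominance together with submodularity gives ε ρₑ(M) ≤ ε ρₑ(Mᵢ) ≤ ρ_{eᵢ}(Mᵢ).
-- At most deg_{M*}(v) ≤ b(v) ≤ deg_M(v) edges are charged to v, so the charges at v are
-- covered by the increments of the steps at v.  Each step is counted at its two endpoints and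
-- the increments telescope to f(M), whence ε Σ_{e ∈ M*∖M} ρₑ(M) ≤ 2 f(M), while submodularity
-- gives f(M*) ≤ f(M) + Σ_{e ∈ M*∖M} ρₑ(M).

open import Defs
open import Level using (Level)
open import Data.Bool using (T; true)
open import Data.Empty using (⊥-elim)
open import Data.Nat as ℕ using (ℕ; zero; suc; z≤n; s≤s)
import Data.Nat.Properties as ℕ
open import Data.Fin using (Fin; toℕ; zero; suc; fromℕ; fromℕ<)
open import Data.Fin.Properties using (_≟_; ¬∀⟶∃¬-smallest; toℕ-fromℕ; toℕ-fromℕ<; toℕ-inject)
open import Data.Fin.Subset using (Subset; _∈_; _∉_; _⊆_; _∪_; _∩_; ⁅_⁆; ∣_∣; ⊥; inside; outside) renaming (_-_ to _-ˢ_)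
open import Data.Fin.Subset.Properties
open import Data.List using (List; []; _∷_; length; filter; map; take; lookup; allFin; tabulate; _∷ʳ_)
open import Data.List.Properties using (take-take; take-suc; take-all; map-tabulate; tabulate-lookup)
open import Data.List.Membership.Propositional using () renaming (_∈_ to _∈ₗ_)
open import Data.List.Membership.Propositional.Properties using (∈-filter⁻; ∈-filter⁺; ∈-allFin; ∈-lookup)
import Data.List.Relation.Unary.All as All
open import Data.List.Relation.Unary.AllPairs using (_∷_)
open import Data.List.Relation.Unary.Any using (here; there)
open import Data.List.Relation.Unary.Unique.Propositional using (Unique)
open import Data.List.Relation.Unary.Unique.Propositional.Properties using (filter⁺; allFin⁺)
open import Data.Product using (_×_; _,_; proj₁; proj₂; ∃)
open import Data.Sum using (inj₁; inj₂)
open import Data.Vec as Vec using ([]; _∷_)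
open import Data.Vec.Properties using (lookup∘tabulate; []=⇒lookup; lookup⇒[]=)
open import Function using (_∘_; _$_; id)
open import Relation.Binary.Bundles using (Poset)
open import Relation.Binary.Structures using (IsTotalOrder)
open import Relation.Binary.PropositionalEquality as ≡ using (_≡_; cong; subst)
open import Relation.Nullary using (¬_; Dec; yes; no; does; isYes; ¬?)
open import Relation.Nullary.Decidable using (_⊎-dec_; _×-dec_; dec-true; toWitness; isYes≗does)
open import Relation.Unary using (Decidable)

module OrderedFieldProperties {c ℓ₁ ℓ₂} (F : OrderedField c ℓ₁ ℓ₂) where
  open OrderedField F hiding (zero) renaming (+-mono-≤ to +-monoˡ-≤)
  open import Algebra.Properties.Ring ring using (-‿distribʳ-*)

  poset : Poset c ℓ₁ ℓ₂
  poset = record { isPartialOrder = IsTotalOrder.isPartialOrder isTotalOrder }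

  open Poset poset public using () renaming (refl to ≤-refl; trans to ≤-trans)
  open import Relation.Binary.Reasoning.PartialOrder poset

  +-monoʳ-≤ : ∀ x {a b} → a ≤ b → (x + a) ≤ (x + b)
  +-monoʳ-≤ x {a} {b} a≤b = begin
    x + a  ≈⟨ +-comm x a ⟩
    a + x  ≤⟨ +-monoˡ-≤ x a≤b ⟩
    b + x  ≈⟨ +-comm b x ⟩
    x + b  ∎

  +-mono-≤ : ∀ {a b x y} → a ≤ b → x ≤ y → (a + x) ≤ (b + y)
  +-mono-≤ {b = b} {x} a≤b x≤y = ≤-trans (+-monoˡ-≤ x a≤b) (+-monoʳ-≤ b x≤y)

  x≈y+[x-y] : ∀ x y → x ≈ y + (x - y)
  x≈y+[x-y] x y = begin-equality
    x              ≈⟨ +-identityˡ x ⟨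
    0# + x         ≈⟨ +-congʳ (-‿inverseʳ y) ⟨
    (y - y) + x    ≈⟨ +-assoc y (- y) x ⟩
    y + (- y + x)  ≈⟨ +-congˡ (+-comm (- y) x) ⟩
    y + (x - y)    ∎

  [y-x]+[z-y]≈z-x : ∀ x y z → (y - x) + (z - y) ≈ z - x
  [y-x]+[z-y]≈z-x x y z = begin-equality
    (y - x) + (z - y)  ≈⟨ +-comm (y - x) (z - y) ⟩
    (z - y) + (y - x)  ≈⟨ +-assoc (z - y) y (- x) ⟨
    ((z - y) + y) - x  ≈⟨ +-congʳ (trans (+-comm (z - y) y) (sym (x≈y+[x-y] z y))) ⟩
    z - x              ∎

  x*y+[y+y]≈[2+x]*y : ∀ x y → (x * y) + (y + y) ≈ (2# + x) * y
  x*y+[y+y]≈[2+x]*y x y = begin-equality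
    x * y + (y + y)            ≈⟨ +-comm (x * y) (y + y) ⟩
    (y + y) + x * y            ≈⟨ +-congʳ (+-cong (*-identityˡ y) (*-identityˡ y)) ⟨
    (1# * y + 1# * y) + x * y  ≈⟨ +-congʳ (distribʳ y 1# 1#) ⟨
    2# * y + x * y             ≈⟨ distribʳ y 2# x ⟨
    (2# + x) * y               ∎

  x≤y⇒0≤y-x : ∀ {x y} → x ≤ y → 0# ≤ (y - x)
  x≤y⇒0≤y-x {x} {y} x≤y = begin
    0#     ≈⟨ -‿inverseʳ x ⟨
    x - x  ≤⟨ +-monoˡ-≤ (- x) x≤y ⟩
    y - x  ∎

  x≤y⇒x-y≤0 : ∀ {x y} → x ≤ y → (x - y) ≤ 0#
  x≤y⇒x-y≤0 {x} {y} x≤y = begin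
    x - y  ≤⟨ +-monoˡ-≤ (- y) x≤y ⟩
    y - y  ≈⟨ -‿inverseʳ y ⟩
    0#     ∎

  0≤y-x⇒x≤y : ∀ {x y} → 0# ≤ (y - x) → x ≤ y
  0≤y-x⇒x≤y {x} {y} 0≤y-x = begin
    x            ≈⟨ +-identityˡ x ⟨
    0# + x       ≤⟨ +-monoˡ-≤ x 0≤y-x ⟩
    (y - x) + x  ≈⟨ +-comm (y - x) x ⟩
    x + (y - x)  ≈⟨ x≈y+[x-y] y x ⟨
    y            ∎

  *-monoˡ-≤-nonNeg : ∀ {x a b} → 0# ≤ x → a ≤ b → (x * a) ≤ (x * b)
  *-monoˡ-≤-nonNeg {x} {a} {b} 0≤x a≤b = 0≤y-x⇒x≤y (begin
    0#               ≤⟨ *-nonneg 0≤x (x≤y⇒0≤y-x a≤b) ⟩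
    x * (b - a)      ≈⟨ distribˡ x b (- a) ⟩
    x * b + x * - a  ≈⟨ +-congˡ (-‿distribʳ-* x a) ⟨
    x * b - x * a    ∎)

module Summation {c ℓ₁ ℓ₂} (F : OrderedField c ℓ₁ ℓ₂) where
  open OrderedField F hiding (zero) renaming (+-mono-≤ to +-monoˡ-≤)
  open OrderedFieldProperties F
  open import Relation.Binary.Reasoning.PartialOrder poset
  open import Algebra.Properties.Semiring.Sum semiring public using (sum-syntax)
  open import Algebra.Properties.Semiring.Sum semiring using (sum-cong-≋; ∑-distrib-+; sum-replicate-zero)
  open import Algebra.Properties.CommutativeSemigroup +-commutativeSemigroup using (interchange)
  open import Data.Bool using (if_then_else_)

  private variable
    a b p : Level
    A : Set a
    B : Set b

  [_]·_ : ∀ {P : Set p} → Dec P → Carrier → Carrier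
  [ P? ]· x = if does P? then x else 0#

  sumMap : (A → Carrier) → List A → Carrier
  sumMap w []       = 0#
  sumMap w (x ∷ xs) = w x + sumMap w xs

  sumMap-cong : ∀ {u w : A → Carrier} xs → (∀ x → u x ≈ w x) → sumMap u xs ≈ sumMap w xs
  sumMap-cong []       u≈w = refl
  sumMap-cong (x ∷ xs) u≈w = +-cong (u≈w x) (sumMap-cong xs u≈w)

  sumMap-+ : ∀ (u w : A → Carrier) xs → sumMap (λ x → u x + w x) xs ≈ sumMap u xs + sumMap w xs
  sumMap-+ u w []       = sym (+-identityʳ 0#)
  sumMap-+ u w (x ∷ xs) = trans (+-congˡ (sumMap-+ u w xs)) (interchange (u x) (w x) _ _)

  *-distribˡ-sumMap : ∀ y (w : A → Carrier) xs → y * sumMap w xs ≈ sumMap (λ x → y * w x) xs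
  *-distribˡ-sumMap y w []       = zeroʳ y
  *-distribˡ-sumMap y w (x ∷ xs) = trans (distribˡ y (w x) _) (+-congˡ (*-distribˡ-sumMap y w xs))

  sumMap-nonNeg : ∀ (w : A → Carrier) xs → (∀ {x} → x ∈ₗ xs → 0# ≤ w x) → 0# ≤ sumMap w xs
  sumMap-nonNeg w []       _   = ≤-refl
  sumMap-nonNeg w (x ∷ xs) 0≤w = begin
    0#                 ≈⟨ +-identityʳ 0# ⟨
    0# + 0#            ≤⟨ +-mono-≤ (0≤w (here ≡.refl)) (sumMap-nonNeg w xs (0≤w ∘ there)) ⟩
    w x + sumMap w xs  ∎

  sumMap-tabulate : ∀ {n} (w : A → Carrier) (g : Fin n → A) → sumMap w (tabulate g) ≡ ∑[ i < n ] w (g i)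
  sumMap-tabulate {n = zero}  w g = ≡.refl
  sumMap-tabulate {n = suc n} w g = cong (w (g zero) +_) (sumMap-tabulate w (g ∘ suc))

  sumMap-filter-∷ : ∀ {P : A → Set p} (P? : Decidable P) (w : A → Carrier) x xs →
                    sumMap w (filter P? (x ∷ xs)) ≈ [ P? x ]· w x + sumMap w (filter P? xs)
  sumMap-filter-∷ P? w x xs with P? x
  ... | yes _ = refl
  ... | no _  = sym (+-identityˡ _)

  sumMap-≤-pairing : ∀ (u : A → Carrier) (w : B → Carrier) xs ys →
                     (∀ {x y} → x ∈ₗ xs → y ∈ₗ ys → u x ≤ w y) → (∀ {y} → y ∈ₗ ys → 0# ≤ w y) →
                     (∀ {x} → x ∈ₗ xs → length xs ℕ.≤ length ys) → sumMap u xs ≤ sumMap w ys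
  sumMap-≤-pairing u w []       ys       _   0≤w _   = sumMap-nonNeg w ys 0≤w
  sumMap-≤-pairing u w (x ∷ xs) []       _   _   len with () ← len (here ≡.refl)
  sumMap-≤-pairing u w (x ∷ xs) (y ∷ ys) u≤w 0≤w len =
    +-mono-≤ (u≤w (here ≡.refl) (here ≡.refl))
             (sumMap-≤-pairing u w xs ys (λ x∈ y∈ → u≤w (there x∈) (there y∈)) (0≤w ∘ there)
                               (λ _ → ℕ.≤-pred (len (here ≡.refl))))

  ∑-mono-≤ : ∀ {n} {u w : Fin n → Carrier} → (∀ i → u i ≤ w i) → (∑[ i < n ] u i) ≤ (∑[ i < n ] w i)
  ∑-mono-≤ {n = zero}  u≤w = ≤-refl
  ∑-mono-≤ {n = suc n} u≤w = +-mono-≤ (u≤w zero) (∑-mono-≤ (u≤w ∘ suc))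

  ∑-[≟]· : ∀ {n} (j : Fin n) x → ∑[ i < n ] [ i ≟ j ]· x ≈ x
  ∑-[≟]· {n = suc n} zero    x = trans (+-congˡ (sum-replicate-zero n)) (+-identityʳ x)
  ∑-[≟]· {n = suc n} (suc j) x = trans (+-congˡ (∑-[≟]· j x)) (+-identityˡ x)

  []·-⊎-dec : ∀ {P : Set a} {Q : Set b} (P? : Dec P) (Q? : Dec Q) x →
              ¬ (P × Q) → [ P? ⊎-dec Q? ]· x ≈ [ P? ]· x + [ Q? ]· x
  []·-⊎-dec (yes p) (yes q) x ¬p×q = ⊥-elim (¬p×q (p , q))
  []·-⊎-dec (yes _) (no _)  x _    = sym (+-identityʳ x)
  []·-⊎-dec (no _)  (yes _) x _    = sym (+-identityˡ x)
  []·-⊎-dec (no _)  (no _)  x _    = sym (+-identityʳ 0#)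

  ∑-sumMap-filter : ∀ {n} {P : Fin n → A → Set p} (P? : ∀ i → Decidable (P i)) (w : A → Carrier) xs →
                    ∑[ i < n ] sumMap w (filter (P? i) xs) ≈ sumMap (λ x → ∑[ i < n ] [ P? i x ]· w x) xs
  ∑-sumMap-filter {n = n} P? w []       = sum-replicate-zero n
  ∑-sumMap-filter {n = n} P? w (x ∷ xs) = begin-equality
    ∑[ i < n ] sumMap w (filter (P? i) (x ∷ xs))
      ≈⟨ sum-cong-≋ (λ i → sumMap-filter-∷ (P? i) w x xs) ⟩
    ∑[ i < n ] ([ P? i x ]· w x + sumMap w (filter (P? i) xs))
      ≈⟨ ∑-distrib-+ (λ i → [ P? i x ]· w x) _ ⟩
    ∑[ i < n ] [ P? i x ]· w x + ∑[ i < n ] sumMap w (filter (P? i) xs)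
      ≈⟨ +-congˡ (∑-sumMap-filter P? w xs) ⟩
    ∑[ i < n ] [ P? i x ]· w x + sumMap (λ y → ∑[ i < n ] [ P? i y ]· w y) xs
      ∎

  ∑-telescope : ∀ n (g : ℕ → Carrier) → ∑[ i < n ] (g (suc (toℕ i)) - g (toℕ i)) ≈ g n - g 0
  ∑-telescope zero    g = sym (-‿inverseʳ (g 0))
  ∑-telescope (suc n) g = begin-equality
    (g 1 - g 0) + ∑[ i < n ] (g (suc (suc (toℕ i))) - g (suc (toℕ i)))
      ≈⟨ +-congˡ (∑-telescope n (g ∘ suc)) ⟩
    (g 1 - g 0) + (g (suc n) - g 1)
      ≈⟨ [y-x]+[z-y]≈z-x (g 0) (g 1) (g (suc n)) ⟩
    g (suc n) - g 0
      ∎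

least-counterexample : ∀ {p} {Q : ℕ → Set p} → Decidable Q → ∀ {k} → ¬ Q k →
                       ∃ λ j → ¬ Q j × (∀ {i} → i ℕ.< j → Q i)
least-counterexample {Q = Q} Q? {k} ¬Qk
  with ¬∀⟶∃¬-smallest (suc k) (Q ∘ toℕ) (Q? ∘ toℕ) (λ ∀Q → ¬Qk (subst Q (toℕ-fromℕ k) (∀Q (fromℕ k))))
... | j , ¬Qj , Q-below = toℕ j , ¬Qj , λ i<j →
  subst Q (≡.trans (toℕ-inject (fromℕ< i<j)) (toℕ-fromℕ< i<j)) (Q-below (fromℕ< i<j))

∣p∪q∣≤∣p∣+∣q∣ : ∀ {n} (p q : Subset n) → ∣ p ∪ q ∣ ℕ.≤ ∣ p ∣ ℕ.+ ∣ q ∣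
∣p∪q∣≤∣p∣+∣q∣ []            []            = z≤n
∣p∪q∣≤∣p∣+∣q∣ (inside ∷ p)  (inside ∷ q)  =
  s≤s (ℕ.≤-trans (∣p∪q∣≤∣p∣+∣q∣ p q) (ℕ.+-monoʳ-≤ ∣ p ∣ (ℕ.n≤1+n ∣ q ∣)))
∣p∪q∣≤∣p∣+∣q∣ (inside ∷ p)  (outside ∷ q) = s≤s (∣p∪q∣≤∣p∣+∣q∣ p q)
∣p∪q∣≤∣p∣+∣q∣ (outside ∷ p) (inside ∷ q)  =
  ℕ.≤-trans (s≤s (∣p∪q∣≤∣p∣+∣q∣ p q)) (ℕ.≤-reflexive (≡.sym (ℕ.+-suc ∣ p ∣ ∣ q ∣)))
∣p∪q∣≤∣p∣+∣q∣ (outside ∷ p) (outside ∷ q) = ∣p∪q∣≤∣p∣+∣q∣ p q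

∪-monoʳ-⊆ : ∀ {n} (p : Subset n) {q r} → q ⊆ r → p ∪ q ⊆ p ∪ r
∪-monoʳ-⊆ p {q} {r} q⊆r x∈p∪q with x∈p∪q⁻ p q x∈p∪q
... | inj₁ x∈p = p⊆p∪q r x∈p
... | inj₂ x∈q = q⊆p∪q p r (q⊆r x∈q)

unique-length≤∣p∣ : ∀ {n} {xs : List (Fin n)} (p : Subset n) → Unique xs → (∀ {x} → x ∈ₗ xs → x ∈ p) →
                    length xs ℕ.≤ ∣ p ∣
unique-length≤∣p∣ {xs = []}     p _                   _    = z≤n
unique-length≤∣p∣ {xs = x ∷ xs} p (x∉xs ∷ xs-unique) xs⊆p =
  ℕ.≤-trans (s≤s xs≤∣p-ˢx∣) (x∈p⇒∣p-x∣<∣p∣ (xs⊆p (here ≡.refl)))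
  where
  xs≤∣p-ˢx∣ : length xs ℕ.≤ ∣ p -ˢ x ∣
  xs≤∣p-ˢx∣ = unique-length≤∣p∣ (p -ˢ x) xs-unique
    (λ y∈xs → x∈p∧x≢y⇒x∈p-y (xs⊆p (there y∈xs)) (λ y≡x → All.lookup x∉xs y∈xs (≡.sym y≡x)))

module GraphProperties {n m} (G : SimpleGraph n m) where
  open SimpleGraph G

  incidentTo? : ∀ v e → Dec (IncidentTo G v e)
  incidentTo? v e = (v ≟ proj₁ (ends e)) ⊎-dec (v ≟ proj₂ (ends e))

  incident?≡does : ∀ v e → incident? G v e ≡ does (incidentTo? v e)
  incident?≡does v e with v ≟ proj₁ (ends e)
  ... | yes _ = ≡.refl
  ... | no _  = isYes≗does (v ≟ proj₂ (ends e))

  lookup-δ : ∀ v e → Vec.lookup (δ G v) e ≡ does (incidentTo? v e)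
  lookup-δ v e = ≡.trans (lookup∘tabulate (incident? G v) e) (incident?≡does v e)

  ∈δ⇒incidentTo : ∀ {v e} → e ∈ δ G v → IncidentTo G v e
  ∈δ⇒incidentTo {v} {e} e∈δv = toWitness (subst T (≡.sym isYes≡true) _)
    where
    isYes≡true : isYes (incidentTo? v e) ≡ true
    isYes≡true = ≡.trans (isYes≗does (incidentTo? v e)) (≡.trans (≡.sym (lookup-δ v e)) ([]=⇒lookup e∈δv))

  incidentTo⇒∈δ : ∀ {v e} → IncidentTo G v e → e ∈ δ G v
  incidentTo⇒∈δ {v} {e} v∼e = lookup⇒[]= e (δ G v) (≡.trans (lookup-δ v e) (dec-true (incidentTo? v e) v∼e))

  deg-mono : ∀ {A B} v → A ⊆ B → deg G A v ℕ.≤ deg G B v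
  deg-mono {A} v A⊆B = p⊆q⇒∣p∣≤∣q∣ λ x∈A∩δv →
    let x∈A , x∈δv = x∈p∩q⁻ A (δ G v) x∈A∩δv in x∈p∩q⁺ (A⊆B x∈A , x∈δv)

  bMatching-⊆ : ∀ {b A B} → IsBMatching G b B → A ⊆ B → IsBMatching G b A
  bMatching-⊆ B-bMatching A⊆B v = ℕ.≤-trans (deg-mono v A⊆B) (B-bMatching v)

  saturated-⊆ : ∀ {b A B v} → IsBMatching G b B → A ⊆ B → Saturated G b A v → Saturated G b B v
  saturated-⊆ {v = v} B-bMatching A⊆B A-saturated =
    ℕ.≤-antisym (B-bMatching v) (subst (ℕ._≤ _) A-saturated (deg-mono v A⊆B))

  available? : ∀ b A e → Dec (Available G b A e)
  available? b A e = ¬? (e ∈? A) ×-dec ¬? (deg G A (proj₁ (ends e)) ℕ.≟ b (proj₁ (ends e)))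
                                  ×-dec ¬? (deg G A (proj₂ (ends e)) ℕ.≟ b (proj₂ (ends e)))

  available⇒unsaturated : ∀ {b A e v} → Available G b A e → IncidentTo G v e → ¬ Saturated G b A v
  available⇒unsaturated (_ , unsaturated₁ , _) (inj₁ ≡.refl) = unsaturated₁
  available⇒unsaturated (_ , _ , unsaturated₂) (inj₂ ≡.refl) = unsaturated₂

  ¬available⇒saturated-end : ∀ {b A e} → e ∉ A → ¬ Available G b A e →
                             ∃ λ v → IncidentTo G v e × Saturated G b A v
  ¬available⇒saturated-end {b} {A} {e} e∉A ¬available
    with deg G A (proj₁ (ends e)) ℕ.≟ b (proj₁ (ends e)) | deg G A (proj₂ (ends e)) ℕ.≟ b (proj₂ (ends e))
  ... | yes saturated₁ | _              = proj₁ (ends e) , inj₁ ≡.refl , saturated₁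
  ... | no _           | yes saturated₂ = proj₂ (ends e) , inj₂ ≡.refl , saturated₂
  ... | no ¬saturated₁ | no ¬saturated₂ = ⊥-elim (¬available (e∉A , ¬saturated₁ , ¬saturated₂))

  ∈⇒∈toSet : ∀ {x xs} → x ∈ₗ xs → x ∈ toSet G xs
  ∈⇒∈toSet {x}          (here ≡.refl) = p⊆p∪q _ (x∈⁅x⁆ x)
  ∈⇒∈toSet {xs = y ∷ _} (there x∈xs)  = q⊆p∪q ⁅ y ⁆ _ (∈⇒∈toSet x∈xs)

  toSet-∷ʳ : ∀ xs x → toSet G (xs ∷ʳ x) ≡ toSet G xs ∪ ⁅ x ⁆
  toSet-∷ʳ []       x = ≡.trans (∪-identityʳ ⁅ x ⁆) (≡.sym (∪-identityˡ ⁅ x ⁆))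
  toSet-∷ʳ (y ∷ xs) x = ≡.trans (cong (⁅ y ⁆ ∪_) (toSet-∷ʳ xs x)) (≡.sym (∪-assoc ⁅ y ⁆ (toSet G xs) ⁅ x ⁆))

  toSet-take-⊆ : ∀ j xs → toSet G (take j xs) ⊆ toSet G xs
  toSet-take-⊆ zero    xs       = ⊥⊆
  toSet-take-⊆ (suc j) []       = id
  toSet-take-⊆ (suc j) (x ∷ xs) = ∪-monoʳ-⊆ ⁅ x ⁆ (toSet-take-⊆ j xs)

  toSet-take-mono : ∀ {i j} xs → i ℕ.≤ j → toSet G (take i xs) ⊆ toSet G (take j xs)
  toSet-take-mono {i} {j} xs i≤j
    rewrite ≡.sym (cong (λ l → take l xs) (ℕ.m≤n⇒m⊓n≡m i≤j)) | ≡.sym (take-take i j xs)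
    = toSet-take-⊆ i (take j xs)

  ∣toSet-map∩q∣≤length-filter : ∀ {a p} {A : Set a} (g : A → Fin m) xs (q : Subset m) {P : Fin m → Set p}
                                 (P? : Decidable P) → (∀ {x} → x ∈ q → P x) →
                                 ∣ toSet G (map g xs) ∩ q ∣ ℕ.≤ length (filter (P? ∘ g) xs)
  ∣toSet-map∩q∣≤length-filter g []       q P? q⊆P =
    ℕ.≤-trans (∣p∩q∣≤∣p∣ ⊥ q) (ℕ.≤-reflexive (∣⊥∣≡0 m))
  ∣toSet-map∩q∣≤length-filter g (x ∷ xs) q {P} P? q⊆P =
    ℕ.≤-trans (ℕ.≤-reflexive (cong ∣_∣ (∩-distribʳ-∪ q ⁅ g x ⁆ S)))
              (ℕ.≤-trans (∣p∪q∣≤∣p∣+∣q∣ (⁅ g x ⁆ ∩ q) (S ∩ q)) head+tail)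
    where
    S = toSet G (map g xs)
    tail = ∣toSet-map∩q∣≤length-filter g xs q P? q⊆P
    head+tail : ∣ ⁅ g x ⁆ ∩ q ∣ ℕ.+ ∣ S ∩ q ∣ ℕ.≤ length (filter (P? ∘ g) (x ∷ xs))
    head+tail with P? (g x)
    ... | yes _   = ℕ.+-mono-≤ (ℕ.≤-trans (∣p∩q∣≤∣p∣ ⁅ g x ⁆ q) (ℕ.≤-reflexive (∣⁅x⁆∣≡1 (g x)))) tail
    ... | no ¬Pgx = ℕ.+-mono-≤ (ℕ.≤-trans (p⊆q⇒∣p∣≤∣q∣ ⁅gx⁆∩q⊆⊥) (ℕ.≤-reflexive (∣⊥∣≡0 m))) tail
      where
      ⁅gx⁆∩q⊆⊥ : ⁅ g x ⁆ ∩ q ⊆ ⊥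
      ⁅gx⁆∩q⊆⊥ y∈ = let y∈⁅gx⁆ , y∈q = x∈p∩q⁻ ⁅ g x ⁆ q y∈
                    in ⊥-elim (¬Pgx (subst P (x∈⁅y⁆⇒x≡y (g x) y∈⁅gx⁆) (q⊆P y∈q)))

module SubmodularProperties {c ℓ₁ ℓ₂} (F : OrderedField c ℓ₁ ℓ₂) {n m} (G : SimpleGraph n m)
  {f : Subset m → OrderedField.Carrier F} (f-monotone : Monotone G F f) where

  open OrderedField F hiding (zero) renaming (+-mono-≤ to +-monoˡ-≤)
  open OrderedFieldProperties F
  open Summation F
  open import Relation.Binary.Reasoning.PartialOrder poset

  ρ-nonNeg : ∀ e A → 0# ≤ ρ G F f e A
  ρ-nonNeg e A = x≤y⇒0≤y-x (f-monotone A (A ∪ ⁅ e ⁆) (p⊆p∪q ⁅ e ⁆))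

  ρ-antitone : Submodular G F f → ∀ {A B} e → A ⊆ B → ρ G F f e B ≤ ρ G F f e A
  ρ-antitone f-submodular {A} {B} e A⊆B with e ∈? B
  ... | no e∉B  = f-submodular A B e A⊆B e∉B
  ... | yes e∈B = ≤-trans (x≤y⇒x-y≤0 (f-monotone (B ∪ ⁅ e ⁆) B B∪⁅e⁆⊆B)) (ρ-nonNeg e A)
    where
    B∪⁅e⁆⊆B : B ∪ ⁅ e ⁆ ⊆ B
    B∪⁅e⁆⊆B x∈ with x∈p∪q⁻ B ⁅ e ⁆ x∈
    ... | inj₁ x∈B    = x∈B
    ... | inj₂ x∈⁅e⁆ = subst (_∈ B) (≡.sym (x∈⁅y⁆⇒x≡y e x∈⁅e⁆)) e∈B

  f-∪≤f+sumMap-ρ : Submodular G F f → ∀ A ds → f (A ∪ toSet G ds) ≤ (f A + sumMap (λ d → ρ G F f d A) ds)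
  f-∪≤f+sumMap-ρ f-submodular A [] = begin
    f (A ∪ ⊥)  ≡⟨ cong f (∪-identityʳ A) ⟩
    f A        ≈⟨ +-identityʳ (f A) ⟨
    f A + 0#   ∎
  f-∪≤f+sumMap-ρ f-submodular A (d ∷ ds) = begin
    f (A ∪ (⁅ d ⁆ ∪ S))
      ≡⟨ cong f (≡.trans (cong (A ∪_) (∪-comm ⁅ d ⁆ S)) (≡.sym (∪-assoc A S ⁅ d ⁆))) ⟩
    f ((A ∪ S) ∪ ⁅ d ⁆)
      ≈⟨ x≈y+[x-y] _ (f (A ∪ S)) ⟩
    f (A ∪ S) + ρ G F f d (A ∪ S)
      ≤⟨ +-mono-≤ (f-∪≤f+sumMap-ρ f-submodular A ds) (ρ-antitone f-submodular d (p⊆p∪q S)) ⟩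
    (f A + Σρ) + ρ G F f d A
      ≈⟨ +-assoc (f A) Σρ _ ⟩
    f A + (Σρ + ρ G F f d A)
      ≈⟨ +-congˡ (+-comm Σρ _) ⟩
    f A + (ρ G F f d A + Σρ)
      ∎
    where
    S = toSet G ds
    Σρ = sumMap (λ d → ρ G F f d A) ds

module IncidenceSums {c ℓ₁ ℓ₂} (F : OrderedField c ℓ₁ ℓ₂) {n m} (G : SimpleGraph n m) where
  open OrderedField F hiding (zero)
  open OrderedFieldProperties F
  open Summation F
  open GraphProperties G
  open SimpleGraph G
  open import Relation.Binary.Reasoning.PartialOrder poset
  open import Algebra.Properties.Semiring.Sum semiring using (sum-cong-≋; ∑-distrib-+)

  ∑-incidentTo : ∀ e x → ∑[ v < n ] [ incidentTo? v e ]· x ≈ x + x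
  ∑-incidentTo e x = begin-equality
    ∑[ v < n ] [ incidentTo? v e ]· x
      ≈⟨ sum-cong-≋ (λ v → []·-⊎-dec (v ≟ p) (v ≟ q) x (¬both-ends v)) ⟩
    ∑[ v < n ] ([ v ≟ p ]· x + [ v ≟ q ]· x)
      ≈⟨ ∑-distrib-+ (λ v → [ v ≟ p ]· x) (λ v → [ v ≟ q ]· x) ⟩
    ∑[ v < n ] [ v ≟ p ]· x + ∑[ v < n ] [ v ≟ q ]· x
      ≈⟨ +-cong (∑-[≟]· p x) (∑-[≟]· q x) ⟩
    x + x
      ∎
    where
    p = proj₁ (ends e)
    q = proj₂ (ends e)
    ¬both-ends : ∀ v → ¬ (v ≡ p × v ≡ q)
    ¬both-ends v (v≡p , v≡q) = loopless e (≡.trans (≡.sym v≡p) v≡q)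

module GreedyAnalysis {c ℓ₁ ℓ₂} (F : OrderedField c ℓ₁ ℓ₂) {n m} (G : SimpleGraph n m) (b : Fin n → ℕ)
  {f : Subset m → OrderedField.Carrier F} (f-normalized : Normalized G F f)
  (f-monotone : Monotone G F f) (f-submodular : Submodular G F f)
  {ε : OrderedField.Carrier F} (0≤ε : OrderedField._≤_ F (OrderedField.0# F) ε)
  (es : List (Fin m))
  (dominant : ∀ i → LocallyDominant G F b f ε (toSet G (take (toℕ i) es)) (lookup es i))
  (M-maximal : IsMaximalBMatching G b (toSet G es)) where

  open OrderedField F hiding (zero) renaming (+-mono-≤ to +-monoˡ-≤)
  open OrderedFieldProperties F
  open Summation F
  open GraphProperties G
  open SubmodularProperties F G f-monotone
  open IncidenceSums F G
  open import Relation.Binary.Reasoning.PartialOrder poset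
  open import Algebra.Properties.Ring ring using (-0#≈0#)
  open import Algebra.Properties.Semiring.Sum semiring using (sum-cong-≗)

  k : ℕ
  k = length es

  edge : Fin k → Fin m
  edge = lookup es

  prefix : ℕ → Subset m
  prefix j = toSet G (take j es)

  M : Subset m
  M = toSet G es

  increment : Fin k → Carrier
  increment i = ρ G F f (edge i) (prefix (toℕ i))

  charge : Fin m → Carrier
  charge e = ε * ρ G F f e M

  prefix-⊆-M : ∀ j → prefix j ⊆ M
  prefix-⊆-M j = toSet-take-⊆ j es

  prefix-k≡M : prefix k ≡ M
  prefix-k≡M = cong (toSet G) (take-all k es ℕ.≤-refl)

  prefix-suc : ∀ i → prefix (suc (toℕ i)) ≡ prefix (toℕ i) ∪ ⁅ edge i ⁆
  prefix-suc i = ≡.trans (cong (toSet G) (take-suc es i)) (toSet-∷ʳ (take (toℕ i) es) (edge i))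

  prefix-bMatching : ∀ j → IsBMatching G b (prefix j)
  prefix-bMatching j = bMatching-⊆ (proj₁ M-maximal) (prefix-⊆-M j)

  edge∈M : ∀ i → edge i ∈ M
  edge∈M i = ∈⇒∈toSet (∈-lookup {xs = es} i)

  sumMap-increment≈f-M : sumMap increment (allFin k) ≈ f M
  sumMap-increment≈f-M = begin-equality
    sumMap increment (allFin k)
      ≡⟨ sumMap-tabulate increment id ⟩
    ∑[ i < k ] increment i
      ≡⟨ sum-cong-≗ (λ i → cong (λ A → f A - f (prefix (toℕ i))) (≡.sym (prefix-suc i))) ⟩
    ∑[ i < k ] (f (prefix (suc (toℕ i))) - f (prefix (toℕ i)))
      ≈⟨ ∑-telescope k (f ∘ prefix) ⟩
    f (prefix k) - f ⊥
      ≈⟨ +-congˡ (trans (-‿cong f-normalized) -0#≈0#) ⟩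
    f (prefix k) + 0#
      ≈⟨ +-identityʳ _ ⟩
    f (prefix k)
      ≡⟨ cong f prefix-k≡M ⟩
    f M
      ∎

  record Blocks (e : Fin m) (v : Fin n) : Set ℓ₂ where
    field
      endpoint  : IncidentTo G v e
      saturated : b v ℕ.≤ deg G M v
      paid      : ∀ i → IncidentTo G v (edge i) → charge e ≤ increment i

  unavailable-at-end : ∀ e → ¬ Available G b (prefix k) e
  unavailable-at-end e = subst (λ A → ¬ Available G b A e) (≡.sym prefix-k≡M) (proj₂ M-maximal e)

  blocker : ∀ e → e ∉ M → ∃ (Blocks e)
  blocker e e∉M with least-counterexample (λ j → available? b (prefix j) e) {k} (unavailable-at-end e)
  ... | j , ¬available-j , available-before-j with ¬available⇒saturated-end (e∉M ∘ prefix-⊆-M j) ¬available-j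
  ... | v , v∼e , v-saturated = v , record
    { endpoint  = v∼e
    ; saturated = subst (ℕ._≤ deg G M v) v-saturated (deg-mono v (prefix-⊆-M j))
    ; paid      = charge≤increment
    }
    where
    charge≤increment : ∀ i → IncidentTo G v (edge i) → charge e ≤ increment i
    charge≤increment i v∼eᵢ = begin
      ε * ρ G F f e M                 ≤⟨ *-monoˡ-≤-nonNeg 0≤ε (ρ-antitone f-submodular e (prefix-⊆-M (toℕ i))) ⟩
      ε * ρ G F f e (prefix (toℕ i))  ≤⟨ proj₂ (dominant i) e adjacent (available-before-j i<j) ⟩
      increment i                     ∎
      where
      i<j : toℕ i ℕ.< j
      i<j = ℕ.≰⇒> λ j≤i → available⇒unsaturated (proj₁ (dominant i)) v∼eᵢ
                            (saturated-⊆ (prefix-bMatching (toℕ i)) (toSet-take-mono es j≤i) v-saturated)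

      adjacent : Adjacent G (edge i) e
      adjacent = (λ eᵢ≡e → e∉M (subst (_∈ M) eᵢ≡e (edge∈M i))) , v , v∼eᵢ , v∼e

  blockingVertex : Fin m → Fin n
  blockingVertex e with e ∈? M
  ... | yes _   = proj₁ (SimpleGraph.ends G e)  -- edges of M are never charged
  ... | no e∉M  = proj₁ (blocker e e∉M)

  blockingVertex-blocks : ∀ e → e ∉ M → Blocks e (blockingVertex e)
  blockingVertex-blocks e e∉M with e ∈? M
  ... | yes e∈M  = ⊥-elim (e∉M e∈M)
  ... | no e∉M′  = proj₂ (blocker e e∉M′)

  stepsAt : Fin n → List (Fin k)
  stepsAt v = filter (λ i → incidentTo? v (edge i)) (allFin k)

  deg-M≤length-stepsAt : ∀ v → deg G M v ℕ.≤ length (stepsAt v)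
  deg-M≤length-stepsAt v = subst (λ xs → ∣ toSet G xs ∩ δ G v ∣ ℕ.≤ length (stepsAt v)) map-edge-allFin
    (∣toSet-map∩q∣≤length-filter edge (allFin k) (δ G v) (incidentTo? v) ∈δ⇒incidentTo)
    where
    map-edge-allFin : map edge (allFin k) ≡ es
    map-edge-allFin = ≡.trans (map-tabulate id edge) (tabulate-lookup es)

  module _ (M* : Subset m) where

    newEdges : List (Fin m)
    newEdges = filter (λ e → e ∈? M* ×-dec ¬? (e ∈? M)) (allFin m)

    f-M*≤f-M+ρ-newEdges : f M* ≤ (f M + sumMap (λ e → ρ G F f e M) newEdges)
    f-M*≤f-M+ρ-newEdges = ≤-trans (f-monotone M* _ M*⊆M∪newEdges) (f-∪≤f+sumMap-ρ f-submodular M newEdges)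
      where
      M*⊆M∪newEdges : M* ⊆ M ∪ toSet G newEdges
      M*⊆M∪newEdges {e} e∈M* with e ∈? M
      ... | yes e∈M = p⊆p∪q _ e∈M
      ... | no e∉M  = q⊆p∪q M _ (∈⇒∈toSet (∈-filter⁺ _ (∈-allFin e) (e∈M* , e∉M)))

    chargedTo : Fin n → List (Fin m)
    chargedTo v = filter (λ e → v ≟ blockingVertex e) newEdges

    ∈chargedTo⁻ : ∀ {v e} → e ∈ₗ chargedTo v → e ∈ M* × Blocks e v
    ∈chargedTo⁻ {e = e} e∈ with ∈-filter⁻ _ {xs = newEdges} e∈
    ... | e∈newEdges , v≡blocker with ∈-filter⁻ _ {xs = allFin m} e∈newEdges
    ... | _ , e∈M* , e∉M = e∈M* , subst (Blocks e) (≡.sym v≡blocker) (blockingVertex-blocks e e∉M)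

    module _ (M*-bMatching : IsBMatching G b M*) where

      length-chargedTo≤length-stepsAt : ∀ {v e} → e ∈ₗ chargedTo v → length (chargedTo v) ℕ.≤ length (stepsAt v)
      length-chargedTo≤length-stepsAt {v} e∈ =
        ℕ.≤-trans (unique-length≤∣p∣ (M* ∩ δ G v) (filter⁺ _ (filter⁺ _ (allFin⁺ m))) chargedTo⊆M*∩δv) $
        ℕ.≤-trans (M*-bMatching v) $
        ℕ.≤-trans (Blocks.saturated (proj₂ (∈chargedTo⁻ e∈))) (deg-M≤length-stepsAt v)
        where
        chargedTo⊆M*∩δv : ∀ {x} → x ∈ₗ chargedTo v → x ∈ M* ∩ δ G v
        chargedTo⊆M*∩δv x∈ = let x∈M* , blocks = ∈chargedTo⁻ x∈ in
          x∈p∩q⁺ (x∈M* , incidentTo⇒∈δ (Blocks.endpoint blocks))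

      sumMap-chargedTo≤sumMap-stepsAt : ∀ v → sumMap charge (chargedTo v) ≤ sumMap increment (stepsAt v)
      sumMap-chargedTo≤sumMap-stepsAt v =
        sumMap-≤-pairing charge increment (chargedTo v) (stepsAt v) charge≤increment
                         (λ _ → ρ-nonNeg _ _) length-chargedTo≤length-stepsAt
        where
        charge≤increment : ∀ {e i} → e ∈ₗ chargedTo v → i ∈ₗ stepsAt v → charge e ≤ increment i
        charge≤increment {i = i} e∈ i∈ =
          Blocks.paid (proj₂ (∈chargedTo⁻ e∈)) i (proj₂ (∈-filter⁻ _ {xs = allFin k} i∈))

      sumMap-charge≤2f-M : sumMap charge newEdges ≤ (f M + f M)
      sumMap-charge≤2f-M = begin
        sumMap charge newEdges
          ≈⟨ sumMap-cong newEdges (λ e → ∑-[≟]· (blockingVertex e) (charge e)) ⟨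
        sumMap (λ e → ∑[ v < n ] [ v ≟ blockingVertex e ]· charge e) newEdges
          ≈⟨ ∑-sumMap-filter (λ v e → v ≟ blockingVertex e) charge newEdges ⟨
        ∑[ v < n ] sumMap charge (chargedTo v)
          ≤⟨ ∑-mono-≤ sumMap-chargedTo≤sumMap-stepsAt ⟩
        ∑[ v < n ] sumMap increment (stepsAt v)
          ≈⟨ ∑-sumMap-filter (λ v i → incidentTo? v (edge i)) increment (allFin k) ⟩
        sumMap (λ i → ∑[ v < n ] [ incidentTo? v (edge i) ]· increment i) (allFin k)
          ≈⟨ sumMap-cong (allFin k) (λ i → ∑-incidentTo (edge i) (increment i)) ⟩
        sumMap (λ i → increment i + increment i) (allFin k)
          ≈⟨ sumMap-+ increment increment (allFin k) ⟩
        sumMap increment (allFin k) + sumMap increment (allFin k)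
          ≈⟨ +-cong sumMap-increment≈f-M sumMap-increment≈f-M ⟩
        f M + f M
          ∎

theorem1 : ∀ {c ℓ₁ ℓ₂} (F : OrderedField c ℓ₁ ℓ₂) → let open OrderedField F in
    ∀ {n m} (G : SimpleGraph n m) (b : Fin n → ℕ) (f : Subset m → Carrier) →
    Normalized G F f → NonNegative G F f → Monotone G F f → Submodular G F f →
    (ε : Carrier) → 0# < ε → ε ≤ 1# →
    (es : List (Fin m)) →
    (∀ i → LocallyDominant G F b f ε (toSet G (take (toℕ i) es)) (lookup es i)) →
    IsMaximalBMatching G b (toSet G es) →
    (M* : Subset m) → IsBMatching G b M* →
    (∀ N → IsBMatching G b N → f N ≤ f M*) →
    (ε * f M*) ≤ ((2# + ε) * f (toSet G es))
theorem1 F G b f normalized _ monotone submodular ε (0≤ε , _) _ es dominant maximal M* M*-bMatching _ = begin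
  ε * f M*                                                ≤⟨ *-monoˡ-≤-nonNeg 0≤ε (f-M*≤f-M+ρ-newEdges M*) ⟩
  ε * (f M + sumMap (λ e → ρ G F f e M) (newEdges M*))    ≈⟨ distribˡ ε (f M) _ ⟩
  ε * f M + ε * sumMap (λ e → ρ G F f e M) (newEdges M*)  ≈⟨ +-congˡ (*-distribˡ-sumMap ε _ (newEdges M*)) ⟩
  ε * f M + sumMap charge (newEdges M*)                   ≤⟨ +-monoʳ-≤ (ε * f M) (sumMap-charge≤2f-M M* M*-bMatching) ⟩
  ε * f M + (f M + f M)                                   ≈⟨ x*y+[y+y]≈[2+x]*y ε (f M) ⟩
  (2# + ε) * f M                                          ∎
  where
  open OrderedField F
  open OrderedFieldProperties F
  open Summation F
  open GreedyAnalysis F G b normalized monotone submodular 0≤ε es dominant maximal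
  open import Relation.Binary.Reasoning.PartialOrder poset
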